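{- Let $G$ be a finite simple graph that has a pair of distinct twin vertices and has at least one isolated vertex, and let $T$ be a minimum twin cover of $G$. Then for $t \geq 1$, $\det(\mu_t(G)) = t|T| + \det(G) + t - 1$.
   Context: Two vertices are twins if they have the same open neighborhood. A minimum twin cover of a graph is a minimum size set of vertices containing at least one vertex of every pair of twin vertices (equivalently, all but one vertex from each class of mutually twin vertices). For a finite simple graph $G$ with $V(G)=\{v_1,\dots,v_n\}$ and $t\ge 1$, the generalized Mycielskian $\mu_t(G)$ has vertex set $\{u_i^s : 1\le i\le n,\ 0\le s\le t\}\cup\{w\}$, where $u_i^0=v_i$. For each edge $v_iv_j$ of $G$, $\mu_t(G)$ has the edge $u_i^0u_j^0$ and the edges $u_i^su_j^{s+1}$ and $u_j^su_i^{s+1}$ for $0\le s<t$; in addition $u_i^t w$ is an edge for every $i$. There are no other edges. A subset $S$ of the vertex set is a determining set if the only automorphism fixing every vertex of $S$ is the identity; $\det(G)$ is the minimum size of a determining set. -}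

module Defs where

open import Data.Bool using (Bool; true; false; _∧_; _∨_)
open import Data.Nat using (ℕ; zero; suc; _≤_; _≡ᵇ_)
import Data.Nat
import Data.Fin as Fin
open import Data.Fin using (Fin; toℕ; remQuot)
open import Data.Fin.Subset using (Subset; _∈_; ∣_∣)
open import Data.Fin.Permutation using (Permutation′; _⟨$⟩ʳ_)
open import Data.Product using (Σ; _×_; _,_)
open import Data.Sum using (_⊎_)
open import Relation.Binary.PropositionalEquality using (_≡_; _≢_)

Adj : ℕ → Set
Adj n = Fin n → Fin n → Bool

IsSimple : ∀ {n} → Adj n → Set
IsSimple {n} G = (∀ (i j : Fin n) → G i j ≡ G j i) × (∀ (i : Fin n) → G i i ≡ false)

Twins : ∀ {n} → Adj n → Fin n → Fin n → Set
Twins {n} G x y = ∀ (z : Fin n) → G x z ≡ G y z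

HasDistinctTwins : ∀ {n} → Adj n → Set
HasDistinctTwins {n} G = Σ (Fin n) λ x → Σ (Fin n) λ y → x ≢ y × Twins G x y

HasIsolatedVertex : ∀ {n} → Adj n → Set
HasIsolatedVertex {n} G = Σ (Fin n) λ v → ∀ (z : Fin n) → G v z ≡ false

IsTwinCover : ∀ {n} → Adj n → Subset n → Set
IsTwinCover {n} G T = ∀ (x y : Fin n) → x ≢ y → Twins G x y → x ∈ T ⊎ y ∈ T

IsMinTwinCover : ∀ {n} → Adj n → Subset n → Set
IsMinTwinCover {n} G T = IsTwinCover G T × (∀ (T' : Subset n) → IsTwinCover G T' → ∣ T ∣ ≤ ∣ T' ∣)

IsAutomorphism : ∀ {n} → Adj n → Permutation′ n → Set
IsAutomorphism {n} G π = ∀ (i j : Fin n) → G (π ⟨$⟩ʳ i) (π ⟨$⟩ʳ j) ≡ G i j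

IsDetermining : ∀ {n} → Adj n → Subset n → Set
IsDetermining {n} G S =
  ∀ (π : Permutation′ n) → IsAutomorphism G π →
    (∀ (i : Fin n) → i ∈ S → π ⟨$⟩ʳ i ≡ i) → ∀ (i : Fin n) → π ⟨$⟩ʳ i ≡ i

Det : ∀ {n} → Adj n → ℕ → Set
Det {n} G d = (Σ (Subset n) λ S → IsDetermining G S × ∣ S ∣ ≡ d)
            × (∀ (S : Subset n) → IsDetermining G S → d ≤ ∣ S ∣)

-- Generalized Mycielskian μ_t(G).
-- Vertices: Fin (suc (n * suc t)); zero is w, and suc p stands for u_i^s
-- where (i , s) = remQuot (suc t) p, with i : Fin n and s : Fin (suc t).
data MVert (n t : ℕ) : Set where
  w : MVert n t
  u : Fin n → ℕ → MVert n t

decode : ∀ {n} t → Fin (suc (n Data.Nat.* suc t)) → MVert n t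
decode t Fin.zero = w
decode {n} t (Fin.suc p) with remQuot {n} (suc t) p
... | i , s = u i (toℕ s)

levelLink : ℕ → ℕ → Bool
levelLink s r = ((s ≡ᵇ 0) ∧ (r ≡ᵇ 0)) ∨ ((suc s ≡ᵇ r) ∨ (suc r ≡ᵇ s))

mycAdj : ∀ {n} t → Adj n → MVert n t → MVert n t → Bool
mycAdj t G w w = false
mycAdj t G w (u j r) = r ≡ᵇ t
mycAdj t G (u i s) w = s ≡ᵇ t
mycAdj t G (u i s) (u j r) = G i j ∧ levelLink s r

μ : ∀ {n} (t : ℕ) → Adj n → Adj (suc (n Data.Nat.* suc t))
μ t G a b = mycAdj t G (decode t a) (decode t b)

-- Upper bound: put a minimum determining set D of G on level 0, the twin
-- cover T on every level 1..t, and an isolated vertex i₀ ∉ T (one exists by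
-- minimality of T) on the levels 1..t-1.  An automorphism fixing this set
-- fixes w, the only neighbour of the pendant vertex u_{i₀}^t, and maps every
-- level to itself: copies that have a neighbour one level up by their distance
-- to w, isolated copies because the set misses at most one of them.  On level 0
-- it induces an automorphism of G fixing D, hence the identity, and on each
-- higher level it can only move a vertex to a twin, which T forbids.
--
-- Lower bound: for a determining set S′ of μ_t(G), each level slice of S′ is a
-- twin cover of G.  Let Q be the non-isolated, twin-free vertices met by S′;
-- then T ∪ Q determines G, so det G ≤ |T| + |Q|.  Each slice minus Q is still a
-- twin cover, hence has at least |T| elements, and at least |T| + 1 when the
-- level is below t and contains all isolated vertices.  Copies of isolated
-- vertices on two different levels below t are twins in μ_t(G), so all but at
-- most one of these t levels are of the second kind.

module Submission where

open import Defs
open import Data.Nat using (ℕ; zero; suc; _+_; _*_; _∸_; _≤_; _<_; z≤n; s≤s; s≤s⁻¹; _≡ᵇ_; _<?_)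
open import Data.Nat.Properties
open import Data.Nat.Tactic.RingSolver using (solve-∀)
open import Algebra.Properties.CommutativeMonoid.Sum +-0-commutativeMonoid
  using (sum; sum-syntax; ∑-comm; ∑-distrib-+; sum-cong-≗; sum-init-last)
open import Data.Bool using (Bool; true; false; _∧_; if_then_else_)
import Data.Bool as Bool
open import Data.Bool.Properties using (¬-not; ∧-comm; ∨-comm; ∧-conicalˡ; ∧-conicalʳ; ∧-identityʳ)
open import Data.Fin using (Fin; zero; suc; toℕ; fromℕ; fromℕ<; inject₁; pred; combine; remQuot; _↑ˡ_; _↑ʳ_)
import Data.Fin.Properties as Fin
open import Data.Fin.Properties using (any?; all?)
open import Data.Fin.Subset using (Subset; ∣_∣; _∈_; _∉_; _⊆_; _∪_; _∩_; _─_; _-_; ⁅_⁆; ⊤; inside; outside)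
open import Data.Fin.Subset.Properties
  using (_∈?_; drop-there; ∣p∣≤∣x∷p∣; ∣⊤∣≡n; p⊆q⇒∣p∣≤∣q∣; ∪-identityʳ; p⊆p∪q; q⊆p∪q; x∈⁅x⁆;
         x∈p∩q⁺; x∈p∧x∉q⇒x∈p─q; x∈p∧x≢y⇒x∈p-y; x∈p⇒∣p-x∣<∣p∣)
open import Data.Fin.Permutation
  using (Permutation′; _⟨$⟩ʳ_; _⟨$⟩ˡ_; flip; transpose; permutation; inverseˡ; inverseʳ)
import Data.Fin.Permutation.Components as PC
open import Data.Vec using ([]; _∷_; lookup; tabulate; here; there)
open import Data.Vec.Properties using ([]=⇒lookup; lookup⇒[]=; lookup∘tabulate; tabulate∘lookup; tabulate-cong)
open import Data.Product using (∃; _×_; _,_; proj₁; proj₂)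
open import Data.Sum as Sum using (_⊎_; inj₁; inj₂)
open import Function using (_∘_)
open import Function.Definitions using (Injective)
open import Relation.Nullary using (¬_; ¬?; _×-dec_; yes; no; does; contradiction)
open import Relation.Nullary.Decidable using (dec-true; dec-false)
open import Relation.Unary using (Pred; Decidable)
open import Relation.Binary.PropositionalEquality

-- Finite sums and sizes of subsets

iverson : Bool → ℕ
iverson b = if b then 1 else 0

∑-mono-≤ : ∀ {m} {f g : Fin m → ℕ} → (∀ i → f i ≤ g i) → sum f ≤ sum g
∑-mono-≤ {zero} f≤g = z≤n
∑-mono-≤ {suc m} f≤g = +-mono-≤ (f≤g zero) (∑-mono-≤ (f≤g ∘ suc))

∑-const : ∀ m c → ∑[ i < m ] c ≡ m * c
∑-const zero c = refl
∑-const (suc m) c = cong (c +_) (∑-const m c)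

term≤∑ : ∀ {m} (f : Fin m → ℕ) i → f i ≤ sum f
term≤∑ f zero = m≤m+n _ _
term≤∑ f (suc i) = ≤-trans (term≤∑ (f ∘ suc) i) (m≤n+m _ (f zero))

∑-++ : ∀ m k (f : Fin (m + k) → ℕ) → sum f ≡ ∑[ i < m ] f (i ↑ˡ k) + ∑[ j < k ] f (m ↑ʳ j)
∑-++ zero k f = refl
∑-++ (suc m) k f = trans (cong (f zero +_) (∑-++ m k (f ∘ suc))) (sym (+-assoc (f zero) _ _))

∑-combine : ∀ m k (f : Fin (m * k) → ℕ) → sum f ≡ ∑[ i < m ] ∑[ s < k ] f (combine i s)
∑-combine zero k f = refl
∑-combine (suc m) k f =
  trans (∑-++ k (m * k) f) (cong (∑[ s < k ] f (s ↑ˡ (m * k)) +_) (∑-combine m k (f ∘ (k ↑ʳ_))))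

∣p∣≡∑ : ∀ {m} (p : Subset m) → ∣ p ∣ ≡ ∑[ i < m ] iverson (lookup p i)
∣p∣≡∑ [] = refl
∣p∣≡∑ (inside ∷ p) = cong suc (∣p∣≡∑ p)
∣p∣≡∑ (outside ∷ p) = ∣p∣≡∑ p

∣p∣≡∣p─q∣+∣p∩q∣ : ∀ {m} (p q : Subset m) → ∣ p ∣ ≡ ∣ p ─ q ∣ + ∣ p ∩ q ∣
∣p∣≡∣p─q∣+∣p∩q∣ [] [] = refl
∣p∣≡∣p─q∣+∣p∩q∣ (outside ∷ p) (inside ∷ q) = ∣p∣≡∣p─q∣+∣p∩q∣ p q
∣p∣≡∣p─q∣+∣p∩q∣ (outside ∷ p) (outside ∷ q) = ∣p∣≡∣p─q∣+∣p∩q∣ p q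
∣p∣≡∣p─q∣+∣p∩q∣ (inside ∷ p) (outside ∷ q) = cong suc (∣p∣≡∣p─q∣+∣p∩q∣ p q)
∣p∣≡∣p─q∣+∣p∩q∣ (inside ∷ p) (inside ∷ q) =
  trans (cong suc (∣p∣≡∣p─q∣+∣p∩q∣ p q)) (sym (+-suc ∣ p ─ q ∣ ∣ p ∩ q ∣))

∣p∪q∣≤∣p∣+∣q∣ : ∀ {m} (p q : Subset m) → ∣ p ∪ q ∣ ≤ ∣ p ∣ + ∣ q ∣
∣p∪q∣≤∣p∣+∣q∣ [] [] = z≤n
∣p∪q∣≤∣p∣+∣q∣ (inside ∷ p) (b ∷ q) =
  s≤s (≤-trans (∣p∪q∣≤∣p∣+∣q∣ p q) (+-monoʳ-≤ ∣ p ∣ (∣p∣≤∣x∷p∣ b q)))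
∣p∪q∣≤∣p∣+∣q∣ (outside ∷ p) (inside ∷ q) =
  ≤-trans (s≤s (∣p∪q∣≤∣p∣+∣q∣ p q)) (≤-reflexive (sym (+-suc ∣ p ∣ ∣ q ∣)))
∣p∪q∣≤∣p∣+∣q∣ (outside ∷ p) (outside ∷ q) = ∣p∪q∣≤∣p∣+∣q∣ p q

x∉p⇒∣p∪⁅x⁆∣≡1+∣p∣ : ∀ {m} {x : Fin m} {p : Subset m} → x ∉ p → ∣ p ∪ ⁅ x ⁆ ∣ ≡ suc ∣ p ∣
x∉p⇒∣p∪⁅x⁆∣≡1+∣p∣ {x = zero} {outside ∷ p} x∉p = cong (suc ∘ ∣_∣) (∪-identityʳ p)
x∉p⇒∣p∪⁅x⁆∣≡1+∣p∣ {x = zero} {inside ∷ p} x∉p = contradiction here x∉p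
x∉p⇒∣p∪⁅x⁆∣≡1+∣p∣ {x = suc x} {outside ∷ p} x∉p = x∉p⇒∣p∪⁅x⁆∣≡1+∣p∣ (x∉p ∘ there)
x∉p⇒∣p∪⁅x⁆∣≡1+∣p∣ {x = suc x} {inside ∷ p} x∉p = cong suc (x∉p⇒∣p∪⁅x⁆∣≡1+∣p∣ (x∉p ∘ there))

meetsAllPairs⇒n≤1+∣p∣ : ∀ {m} (p : Subset m) → (∀ x y → x ≢ y → x ∈ p ⊎ y ∈ p) → m ≤ suc ∣ p ∣
meetsAllPairs⇒n≤1+∣p∣ [] cover = z≤n
meetsAllPairs⇒n≤1+∣p∣ (inside ∷ p) cover = s≤s (meetsAllPairs⇒n≤1+∣p∣ p λ x y x≢y →
  Sum.map drop-there drop-there (cover (suc x) (suc y) (x≢y ∘ Fin.suc-injective)))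
meetsAllPairs⇒n≤1+∣p∣ {suc m} (outside ∷ p) cover = s≤s (subst (_≤ ∣ p ∣) (∣⊤∣≡n m) (p⊆q⇒∣p∣≤∣q∣ ⊤⊆p))
  where
  ⊤⊆p : ⊤ ⊆ p
  ⊤⊆p {x} _ with cover zero (suc x) (λ ())
  ... | inj₂ (there x∈p) = x∈p

∣p∣≤∑∣qₛ∣ : ∀ {m k} (p : Subset m) (q : Fin k → Subset m) →
            (∀ {x} → x ∈ p → ∃ λ s → x ∈ q s) → ∣ p ∣ ≤ ∑[ s < k ] ∣ q s ∣
∣p∣≤∑∣qₛ∣ {m} {k} p q p⊆⋃q = begin
  ∣ p ∣                                           ≡⟨ ∣p∣≡∑ p ⟩
  ∑[ x < m ] iverson (lookup p x)                 ≤⟨ ∑-mono-≤ {m} pointwise ⟩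
  ∑[ x < m ] ∑[ s < k ] iverson (lookup (q s) x)  ≡⟨ ∑-comm (λ x s → iverson (lookup (q s) x)) ⟩
  ∑[ s < k ] ∑[ x < m ] iverson (lookup (q s) x)  ≡⟨ sum-cong-≗ (∣p∣≡∑ ∘ q) ⟨
  ∑[ s < k ] ∣ q s ∣                              ∎
  where
  open ≤-Reasoning
  pointwise : ∀ x → iverson (lookup p x) ≤ ∑[ s < k ] iverson (lookup (q s) x)
  pointwise x with lookup p x in eq
  ... | outside = z≤n
  ... | inside with p⊆⋃q (lookup⇒[]= x p eq)
  ...   | s , x∈qₛ = subst (λ b → iverson b ≤ ∑[ s < k ] iverson (lookup (q s) x))
                           ([]=⇒lookup x∈qₛ) (term≤∑ (λ s → iverson (lookup (q s) x)) s)

subsetOf : ∀ {m p} {P : Pred (Fin m) p} → Decidable P → Subset m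
subsetOf P? = tabulate (does ∘ P?)

∈-subsetOf⁺ : ∀ {m p} {P : Pred (Fin m) p} (P? : Decidable P) {i} → P i → i ∈ subsetOf P?
∈-subsetOf⁺ P? {i} Pi = lookup⇒[]= i _ (trans (lookup∘tabulate _ i) (dec-true (P? i) Pi))

∈-subsetOf⁻ : ∀ {m p} {P : Pred (Fin m) p} (P? : Decidable P) {i} → i ∈ subsetOf P? → P i
∈-subsetOf⁻ P? {i} i∈ with P? i | trans (sym (lookup∘tabulate (does ∘ P?) i)) ([]=⇒lookup i∈)
... | yes Pi | _ = Pi
... | no _ | ()

-- Twins, isolated vertices and automorphisms

Isolated : ∀ {m} → Adj m → Fin m → Set
Isolated {m} A x = ∀ (z : Fin m) → A x z ≡ false

HasTwin : ∀ {m} → Adj m → Fin m → Set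
HasTwin {m} A x = ∃ λ (y : Fin m) → y ≢ x × Twins A x y

NonIsolated : ∀ {m} → Adj m → Fin m → Set
NonIsolated {m} A x = ∃ λ (z : Fin m) → A x z ≡ true

isolated-or-nonIsolated : ∀ {m} (A : Adj m) x → Isolated A x ⊎ NonIsolated A x
isolated-or-nonIsolated A x with any? (λ z → A x z Bool.≟ true)
... | yes nonIsolated = inj₂ nonIsolated
... | no ¬nonIsolated = inj₁ (λ z → ¬-not (λ e → ¬nonIsolated (z , e)))

isolated? : ∀ {m} (A : Adj m) → Decidable (Isolated A)
isolated? A x = all? (λ z → A x z Bool.≟ false)

PairCover : ∀ {m} → (Fin m → Fin m → Set) → Subset m → Set
PairCover {m} R S = ∀ (x y : Fin m) → x ≢ y → R x y → x ∈ S ⊎ y ∈ S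

⟨$⟩ʳ-injective : ∀ {m} (π : Permutation′ m) → Injective _≡_ _≡_ (π ⟨$⟩ʳ_)
⟨$⟩ʳ-injective π {x} {y} πx≡πy = trans (sym (inverseˡ π)) (trans (cong (π ⟨$⟩ˡ_) πx≡πy) (inverseˡ π))

fixed-by-pairCover : ∀ {m} {R : Fin m → Fin m → Set} {S : Subset m} {f : Fin m → Fin m} →
  Injective _≡_ _≡_ f → (∀ x → x ∈ S → f x ≡ x) → PairCover R S →
  ∀ {x} → R (f x) x → f x ≡ x
fixed-by-pairCover {f = f} f-inj f-fixes cover {x} r with f x Fin.≟ x
... | yes fx≡x = fx≡x
... | no fx≢x with cover (f x) x fx≢x r
...   | inj₁ fx∈S = f-inj (f-fixes (f x) fx∈S)
...   | inj₂ x∈S = f-fixes x x∈S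

module GraphProperties {m : ℕ} (A : Adj m) where

  twins-sym : ∀ {x y} → Twins A x y → Twins A y x
  twins-sym tw z = sym (tw z)

  isolated⇒twins : ∀ {x y} → Isolated A x → Isolated A y → Twins A x y
  isolated⇒twins iso-x iso-y z = trans (iso-x z) (sym (iso-y z))

  twins-isolated : ∀ {x y} → Twins A x y → Isolated A x → Isolated A y
  twins-isolated tw iso z = trans (sym (tw z)) (iso z)

  module _ (π : Permutation′ m) (aut : IsAutomorphism A π) where

    automorphism-adj : ∀ x z → A (π ⟨$⟩ʳ x) z ≡ A x (π ⟨$⟩ˡ z)
    automorphism-adj x z = trans (cong (A (π ⟨$⟩ʳ x)) (sym (inverseʳ π))) (aut x (π ⟨$⟩ˡ z))

    flip-isAutomorphism : IsAutomorphism A (flip π)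
    flip-isAutomorphism x y = trans (sym (aut (π ⟨$⟩ˡ x) (π ⟨$⟩ˡ y))) (cong₂ A (inverseʳ π) (inverseʳ π))

    automorphism-twins : ∀ {x y} → Twins A x y → Twins A (π ⟨$⟩ʳ x) (π ⟨$⟩ʳ y)
    automorphism-twins tw z = trans (automorphism-adj _ z) (trans (tw _) (sym (automorphism-adj _ z)))

    automorphism-isolated : ∀ {x} → Isolated A x → Isolated A (π ⟨$⟩ʳ x)
    automorphism-isolated iso z = trans (automorphism-adj _ z) (iso _)

  module _ (A-sym : ∀ i j → A i j ≡ A j i) where

    transpose-isAutomorphism : ∀ {x y} → Twins A x y → IsAutomorphism A (transpose x y)
    transpose-isAutomorphism {x} {y} tw a b =
      trans (swap-row a _) (trans (A-sym a _) (trans (swap-row b a) (A-sym b a)))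
      where
      swap-row : ∀ a z → A (PC.transpose x y a) z ≡ A a z
      swap-row a z with a Fin.≟ x
      ... | yes refl = sym (tw z)
      ... | no _ with a Fin.≟ y
      ...   | yes refl = tw z
      ...   | no _ = refl

    determining⇒twinCover : ∀ {S} → IsDetermining A S → IsTwinCover A S
    determining⇒twinCover {S} det x y x≢y tw with x ∈? S | y ∈? S
    ... | yes x∈S | _ = inj₁ x∈S
    ... | no _ | yes y∈S = inj₂ y∈S
    ... | no x∉S | no y∉S = contradiction (det (transpose x y) (transpose-isAutomorphism tw) fixes-S x) x-moves
      where
      x-moves : transpose x y ⟨$⟩ʳ x ≢ x
      x-moves with x Fin.≟ x
      ... | yes _ = x≢y ∘ sym
      ... | no x≢x = contradiction refl x≢x
      fixes-S : ∀ i → i ∈ S → transpose x y ⟨$⟩ʳ i ≡ i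
      fixes-S i i∈S with i Fin.≟ x
      ... | yes refl = contradiction i∈S x∉S
      ... | no _ with i Fin.≟ y
      ...   | yes refl = contradiction i∈S y∉S
      ...   | no _ = refl

  twinCover-remove : ∀ {C : Subset m} {v} → IsTwinCover A C →
    (∀ y → y ≢ v → Twins A v y → y ∈ C) → IsTwinCover A (C - v)
  twinCover-remove {C} {v} cover twins-in x y x≢y tw with x Fin.≟ v | y Fin.≟ v
  ... | yes refl | _ = inj₂ (x∈p∧x≢y⇒x∈p-y (twins-in y (x≢y ∘ sym) tw) (x≢y ∘ sym))
  ... | no x≢v | yes refl = inj₁ (x∈p∧x≢y⇒x∈p-y (twins-in x x≢y (twins-sym tw)) x≢v)
  ... | no x≢v | no y≢v = Sum.map (λ x∈C → x∈p∧x≢y⇒x∈p-y x∈C x≢v) (λ y∈C → x∈p∧x≢y⇒x∈p-y y∈C y≢v)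
                                  (cover x y x≢y tw)

  twinCover-─ : ∀ {C q : Subset m} → IsTwinCover A C → (∀ x → x ∈ q → ¬ HasTwin A x) → IsTwinCover A (C ─ q)
  twinCover-─ {C} {q} cover twinless x y x≢y tw =
    Sum.map (λ x∈C → x∈p∧x∉q⇒x∈p─q x∈C (λ x∈q → twinless x x∈q (y , x≢y ∘ sym , tw)))
            (λ y∈C → x∈p∧x∉q⇒x∈p─q y∈C (λ y∈q → twinless y y∈q (x , x≢y , twins-sym tw)))
            (cover x y x≢y tw)

minTwinCover-avoids-isolated : ∀ {m} {A : Adj m} {T : Subset m} → IsMinTwinCover A T →
  ∀ {v} → Isolated A v → ∃ λ i₀ → Isolated A i₀ × i₀ ∉ T
minTwinCover-avoids-isolated {A = A} {T} (cover , minimal) {v} v-isolated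
  with any? (λ i → isolated? A i ×-dec ¬? (i ∈? T))
... | yes found = found
... | no ¬found = contradiction (minimal (T - v) smaller-cover) (<⇒≱ (x∈p⇒∣p-x∣<∣p∣ (isolated∈T v-isolated)))
  where
  open GraphProperties
  isolated∈T : ∀ {i} → Isolated A i → i ∈ T
  isolated∈T {i} iso with i ∈? T
  ... | yes i∈T = i∈T
  ... | no i∉T = contradiction (i , iso , i∉T) ¬found
  smaller-cover : IsTwinCover A (T - v)
  smaller-cover = twinCover-remove A cover λ y _ tw → isolated∈T (twins-isolated A tw v-isolated)

-- The generalized Mycielskian

≡ᵇ-true : ∀ {a b} → a ≡ b → (a ≡ᵇ b) ≡ true
≡ᵇ-true {zero} refl = refl
≡ᵇ-true {suc a} refl = ≡ᵇ-true {a} refl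

≡ᵇ-true⁻¹ : ∀ {a b} → (a ≡ᵇ b) ≡ true → a ≡ b
≡ᵇ-true⁻¹ {zero} {zero} _ = refl
≡ᵇ-true⁻¹ {suc a} {suc b} eq = cong suc (≡ᵇ-true⁻¹ eq)

≡ᵇ-false : ∀ {a b} → a ≢ b → (a ≡ᵇ b) ≡ false
≡ᵇ-false {a} {b} a≢b with a ≡ᵇ b in eq
... | true = contradiction (≡ᵇ-true⁻¹ eq) a≢b
... | false = refl

levelLink-sym : ∀ a b → levelLink a b ≡ levelLink b a
levelLink-sym a b rewrite ∧-comm (a ≡ᵇ 0) (b ≡ᵇ 0)
                        | ∨-comm (suc a ≡ᵇ b) (suc b ≡ᵇ a) = refl

levelLink-up : ∀ a → levelLink a (suc a) ≡ true
levelLink-up zero = refl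
levelLink-up (suc a) rewrite ≡ᵇ-true {a} refl = refl

levelLink-down : ∀ a → levelLink (suc a) a ≡ true
levelLink-down a = trans (levelLink-sym (suc a) a) (levelLink-up a)

levelLink-up⁻¹ : ∀ a b → levelLink a (suc b) ≡ true → a ≡ b ⊎ a ≡ suc (suc b)
levelLink-up⁻¹ zero zero _ = inj₁ refl
levelLink-up⁻¹ (suc a) b link with suc a ≡ᵇ b in eq
... | true = inj₁ (≡ᵇ-true⁻¹ eq)
... | false = inj₂ (cong suc (sym (≡ᵇ-true⁻¹ link)))

levelLink-pred : ∀ {m} (s : Fin m) → levelLink (toℕ s) (toℕ (pred s)) ≡ true
levelLink-pred zero = refl
levelLink-pred (suc k) = trans (cong (levelLink (suc (toℕ k))) (Fin.toℕ-inject₁ k)) (levelLink-down (toℕ k))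

toℕ-pred≤ : ∀ {m} (s : Fin m) → toℕ (pred s) ≤ toℕ s
toℕ-pred≤ zero = z≤n
toℕ-pred≤ (suc k) = ≤-trans (≤-reflexive (Fin.toℕ-inject₁ k)) (n≤1+n (toℕ k))

module Mycielskian {n : ℕ} (G : Adj n) (G-sym : ∀ i j → G i j ≡ G j i) (t : ℕ) where

  open GraphProperties

  N : ℕ
  N = suc (n * suc t)

  H : Adj N
  H = μ t G

  w′ : Fin N
  w′ = zero

  u′ : Fin n → Fin (suc t) → Fin N
  u′ i s = suc (combine i s)

  data Vertex : Fin N → Set where
    at-w : Vertex w′
    at-u : ∀ i s → Vertex (u′ i s)

  vertex : ∀ x → Vertex x
  vertex zero = at-w
  vertex (suc p) = subst (Vertex ∘ suc) (Fin.combine-remQuot {n} (suc t) p) (at-u _ _)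

  u′-injective : ∀ {i s j r} → u′ i s ≡ u′ j r → i ≡ j × s ≡ r
  u′-injective {i} {s} {j} {r} eq = Fin.combine-injective i s j r (Fin.suc-injective eq)

  decode-u′ : ∀ i s → decode t (u′ i s) ≡ u i (toℕ s)
  decode-u′ i s = cong (λ (i , s) → u i (toℕ s)) (Fin.remQuot-combine i s)

  H-u′u′ : ∀ i s j r → H (u′ i s) (u′ j r) ≡ (G i j ∧ levelLink (toℕ s) (toℕ r))
  H-u′u′ i s j r = cong₂ (mycAdj t G) (decode-u′ i s) (decode-u′ j r)

  H-w′u′ : ∀ j r → H w′ (u′ j r) ≡ (toℕ r ≡ᵇ t)
  H-w′u′ j r = cong (mycAdj t G w) (decode-u′ j r)

  H-u′w′ : ∀ i s → H (u′ i s) w′ ≡ (toℕ s ≡ᵇ t)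
  H-u′w′ i s = cong (λ a → mycAdj t G a w) (decode-u′ i s)

  H-sym : ∀ x y → H x y ≡ H y x
  H-sym x y with vertex x | vertex y
  ... | at-w | at-w = refl
  ... | at-w | at-u j r = trans (H-w′u′ j r) (sym (H-u′w′ j r))
  ... | at-u i s | at-w = trans (H-u′w′ i s) (sym (H-w′u′ i s))
  ... | at-u i s | at-u j r = begin
    H (u′ i s) (u′ j r)                     ≡⟨ H-u′u′ i s j r ⟩
    G i j ∧ levelLink (toℕ s) (toℕ r)       ≡⟨ cong₂ _∧_ (G-sym i j) (levelLink-sym (toℕ s) (toℕ r)) ⟩
    G j i ∧ levelLink (toℕ r) (toℕ s)       ≡⟨ H-u′u′ j r i s ⟨
    H (u′ j r) (u′ i s)                     ∎
    where open ≡-Reasoning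

  top : Fin (suc t)
  top = fromℕ t

  next : ∀ (s : Fin (suc t)) → toℕ s < t → Fin (suc t)
  next s s<t = fromℕ< (s≤s s<t)

  toℕ-next : ∀ s (s<t : toℕ s < t) → toℕ (next s s<t) ≡ suc (toℕ s)
  toℕ-next s s<t = Fin.toℕ-fromℕ< (s≤s s<t)

  below-top : ∀ (s : Fin (suc t)) → toℕ s ≢ t → toℕ s < t
  below-top s s≢t = ≤∧≢⇒< (s≤s⁻¹ (Fin.toℕ<n s)) s≢t

  H-u′-next : ∀ i s j (s<t : toℕ s < t) → H (u′ i s) (u′ j (next s s<t)) ≡ G i j
  H-u′-next i s j s<t = begin
    H (u′ i s) (u′ j (next s s<t))                   ≡⟨ H-u′u′ i s j _ ⟩
    G i j ∧ levelLink (toℕ s) (toℕ (next s s<t))     ≡⟨ cong (λ r → G i j ∧ levelLink (toℕ s) r) (toℕ-next s s<t) ⟩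
    G i j ∧ levelLink (toℕ s) (suc (toℕ s))          ≡⟨ cong (G i j ∧_) (levelLink-up (toℕ s)) ⟩
    G i j ∧ true                                     ≡⟨ ∧-identityʳ (G i j) ⟩
    G i j                                            ∎
    where open ≡-Reasoning

  H-u′₀u′₀ : ∀ i j → H (u′ i zero) (u′ j zero) ≡ G i j
  H-u′₀u′₀ i j = trans (H-u′u′ i zero j zero) (∧-identityʳ (G i j))

  H-u′-prev : ∀ i k j → H (u′ i (suc k)) (u′ j (inject₁ k)) ≡ G i j
  H-u′-prev i k j = begin
    H (u′ i (suc k)) (u′ j (inject₁ k))                        ≡⟨ H-u′u′ i (suc k) j (inject₁ k) ⟩
    G i j ∧ levelLink (suc (toℕ k)) (toℕ (inject₁ k))
      ≡⟨ cong (λ r → G i j ∧ levelLink (suc (toℕ k)) r) (Fin.toℕ-inject₁ k) ⟩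
    G i j ∧ levelLink (suc (toℕ k)) (toℕ k)                    ≡⟨ cong (G i j ∧_) (levelLink-down (toℕ k)) ⟩
    G i j ∧ true                                               ≡⟨ ∧-identityʳ (G i j) ⟩
    G i j                                                      ∎
    where open ≡-Reasoning

  H-w′-top : ∀ j → H w′ (u′ j top) ≡ true
  H-w′-top j = trans (H-w′u′ j top) (≡ᵇ-true (Fin.toℕ-fromℕ t))

  u′-isolated : ∀ {i} s → Isolated G i → toℕ s < t → Isolated H (u′ i s)
  u′-isolated {i} s iso s<t z with vertex z
  ... | at-w = trans (H-u′w′ i s) (≡ᵇ-false (<⇒≢ s<t))
  ... | at-u j r = trans (H-u′u′ i s j r) (cong (_∧ _) (iso j))

  isolated-u′ : ∀ {i s} → Isolated H (u′ i s) → Isolated G i × toℕ s < t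
  isolated-u′ {i} {s} iso = (λ j → trans (sym (H-u′-next i s j s<t)) (iso (u′ j (next s s<t)))) , s<t
    where
    s<t : toℕ s < t
    s<t = below-top s λ s≡t →
      contradiction (trans (sym (≡ᵇ-true s≡t)) (trans (sym (H-u′w′ i s)) (iso w′))) λ ()

  w′-not-isolated : Fin n → ¬ Isolated H w′
  w′-not-isolated j iso = contradiction (trans (sym (H-w′-top j)) (iso (u′ j top))) λ ()

  u′-twins : ∀ {i j} s → Twins G i j → Twins H (u′ i s) (u′ j s)
  u′-twins {i} {j} s tw z with vertex z
  ... | at-w = trans (H-u′w′ i s) (sym (H-u′w′ j s))
  ... | at-u k r = trans (H-u′u′ i s k r) (trans (cong (_∧ _) (tw k)) (sym (H-u′u′ j s k r)))

  -- w has the two neighbours u′ a top and u′ b top; a copy u′ i s below the top with a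
  -- neighbour u′ j r is also adjacent to u′ j at the two levels s + 1 and pred s.
  pendant-neighbour≡w′ : ∀ {a b : Fin n} → a ≢ b → ∀ y z → H y z ≡ true →
    (∀ z′ → H y z′ ≡ true → z′ ≡ z) → z ≡ w′
  pendant-neighbour≡w′ {a} {b} a≢b y z yz sole with vertex y
  ... | at-w =
    contradiction (proj₁ (u′-injective (trans (sole _ (H-w′-top a)) (sym (sole _ (H-w′-top b)))))) a≢b
  ... | at-u i s with toℕ s ≟ t
  ...   | yes s≡t = sym (sole w′ (trans (H-u′w′ i s) (≡ᵇ-true s≡t)))
  ...   | no s≢t with vertex z
  ...     | at-w = refl
  ...     | at-u j r =
    contradiction (proj₂ (u′-injective (trans (sole _ adj-next) (sym (sole _ adj-pred))))) next≢pred
    where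
    s<t : toℕ s < t
    s<t = below-top s s≢t
    gij : G i j ≡ true
    gij = ∧-conicalˡ _ _ (trans (sym (H-u′u′ i s j r)) yz)
    adj-next : H (u′ i s) (u′ j (next s s<t)) ≡ true
    adj-next = trans (H-u′-next i s j s<t) gij
    adj-pred : H (u′ i s) (u′ j (pred s)) ≡ true
    adj-pred = trans (H-u′u′ i s j (pred s)) (cong₂ _∧_ gij (levelLink-pred s))
    next≢pred : next s s<t ≢ pred s
    next≢pred eq = 1+n≰n (subst (_≤ toℕ s) (trans (sym (cong toℕ eq)) (toℕ-next s s<t)) (toℕ-pred≤ s))

  -- Layer k is the set of vertices at distance t + 1 - k from w.  Every vertex adjacent
  -- to Layer (k + 1) other than w lies in Layer k or Layer (k + 2), which gives the
  -- downward induction showing that automorphisms fixing w preserve all layers.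
  data Layer (k : ℕ) (x : Fin N) : Set where
    layer : ∀ i s → x ≡ u′ i s → toℕ s ≡ k → NonIsolated G i ⊎ k ≡ t → Layer k x

  layer-≢w′ : ∀ {k x} → Layer k x → x ≢ w′
  layer-≢w′ (layer i s refl _ _) ()

  layer-unique : ∀ {k k′ x} → Layer k x → Layer k′ x → k ≡ k′
  layer-unique (layer i s refl refl _) (layer i′ s′ eq refl _) = cong toℕ (proj₂ (u′-injective eq))

  layer-beyond : ∀ {x} → ¬ Layer (suc t) x
  layer-beyond (layer i s _ s≡1+t _) = 1+n≰n (subst (_≤ t) s≡1+t (s≤s⁻¹ (Fin.toℕ<n s)))

  layer-top : ∀ {y} → H w′ y ≡ true → Layer t y
  layer-top {y} adj with vertex y
  ... | at-w = contradiction adj λ ()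
  ... | at-u j r = layer j r refl (≡ᵇ-true⁻¹ (trans (sym (H-w′u′ j r)) adj)) (inj₂ refl)

  layer-top⁻¹ : ∀ {x} → Layer t x → H w′ x ≡ true
  layer-top⁻¹ (layer i s refl s≡t _) = trans (H-w′u′ i s) (≡ᵇ-true s≡t)

  layer-up : ∀ {k x} → Layer k x → k < t → ∃ λ a → Layer (suc k) a × H x a ≡ true
  layer-up (layer i s refl refl (inj₂ s≡t)) s<t = contradiction s≡t (<⇒≢ s<t)
  layer-up (layer i s refl refl (inj₁ (j , gij))) s<t =
    u′ j (next s s<t) ,
    layer j (next s s<t) refl (toℕ-next s s<t) (inj₁ (i , trans (G-sym j i) gij)) ,
    trans (H-u′-next i s j s<t) gij

  layer-down : ∀ {k y a} → y ≢ w′ → Layer (suc k) a → H y a ≡ true → Layer k y ⊎ Layer (suc (suc k)) y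
  layer-down {y = y} y≢w′ a∈ ya with vertex y
  ... | at-w = contradiction refl y≢w′
  ... | at-u i s = u′-layer-down a∈ ya
    where
    u′-layer-down : ∀ {k i s a} → Layer (suc k) a → H (u′ i s) a ≡ true →
                    Layer k (u′ i s) ⊎ Layer (suc (suc k)) (u′ i s)
    u′-layer-down {k} {i} {s} (layer j r refl r≡1+k _) ya =
      Sum.map (λ s≡k → layer i s refl s≡k i-nonIsolated) (λ s≡2+k → layer i s refl s≡2+k i-nonIsolated)
              (levelLink-up⁻¹ (toℕ s) k (subst (λ l → levelLink (toℕ s) l ≡ true) r≡1+k (∧-conicalʳ _ _ adj)))
      where
      adj : (G i j ∧ levelLink (toℕ s) (toℕ r)) ≡ true
      adj = trans (sym (H-u′u′ i s j r)) ya
      i-nonIsolated : ∀ {l} → NonIsolated G i ⊎ l ≡ t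
      i-nonIsolated = inj₁ (j , ∧-conicalˡ _ _ adj)

  Stable : ℕ → Set
  Stable k = ∀ (ψ : Permutation′ N) → IsAutomorphism H ψ → ψ ⟨$⟩ʳ w′ ≡ w′ →
             ∀ {x} → Layer k x → Layer k (ψ ⟨$⟩ʳ x)

  stable-top : Stable t
  stable-top ψ aut ψw {x} x∈t =
    layer-top (trans (cong (λ v → H v (ψ ⟨$⟩ʳ x)) (sym ψw)) (trans (aut w′ x) (layer-top⁻¹ x∈t)))

  stable-beyond : Stable (suc t)
  stable-beyond _ _ _ x∈ = contradiction x∈ layer-beyond

  stable-step : ∀ {k} → k < t → Stable (suc k) → Stable (suc (suc k)) → Stable k
  stable-step {k} k<t up up² ψ aut ψw {x} x∈k with layer-up x∈k k<t
  ... | a , a∈ , xa with layer-down ψx≢w′ (up ψ aut ψw a∈) (trans (aut x a) xa)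
    where
    ψx≢w′ : ψ ⟨$⟩ʳ x ≢ w′
    ψx≢w′ eq = layer-≢w′ x∈k (⟨$⟩ʳ-injective ψ (trans eq (sym ψw)))
  ...   | inj₁ ψx∈k = ψx∈k
  ...   | inj₂ ψx∈2+k = contradiction (layer-unique x∈k x∈2+k) (<⇒≢ (m<n⇒m<1+n (n<1+n k)))
    where
    ψ⁻¹w : flip ψ ⟨$⟩ʳ w′ ≡ w′
    ψ⁻¹w = trans (cong (ψ ⟨$⟩ˡ_) (sym ψw)) (inverseˡ ψ)
    x∈2+k : Layer (suc (suc k)) x
    x∈2+k = subst (Layer _) (inverseˡ ψ) (up² (flip ψ) (flip-isAutomorphism H ψ aut) ψ⁻¹w ψx∈2+k)

  stable-from : ∀ d {k} → d + k ≡ t → Stable k × Stable (suc k)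
  stable-from zero refl = stable-top , stable-beyond
  stable-from (suc d) {k} d+k≡t with stable-from d (trans (+-suc d k) d+k≡t)
  ... | up , up² = stable-step (subst (k <_) d+k≡t (s≤s (m≤n+m k d))) up up² , up

  level-preserved : ∀ (ψ : Permutation′ N) → IsAutomorphism H ψ → ψ ⟨$⟩ʳ w′ ≡ w′ →
    ∀ {i s} → NonIsolated G i ⊎ toℕ s ≡ t → ∃ λ j → ψ ⟨$⟩ʳ u′ i s ≡ u′ j s
  level-preserved ψ aut ψw {i} {s} i-linked
    with proj₁ (stable-from (t ∸ toℕ s) (m∸n+n≡m (s≤s⁻¹ (Fin.toℕ<n s)))) ψ aut ψw (layer i s refl refl i-linked)
  ... | layer j r eq r≡s _ = j , trans eq (cong (u′ j) (Fin.toℕ-injective r≡s))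

  liftMap : (Fin n → Fin n) → Fin N → Fin N
  liftMap f zero = zero
  liftMap f (suc p) = let (i , s) = remQuot {n} (suc t) p in u′ (f i) s

  liftMap-u′ : ∀ f i s → liftMap f (u′ i s) ≡ u′ (f i) s
  liftMap-u′ f i s = cong (λ (i , s) → u′ (f i) s) (Fin.remQuot-combine i s)

  liftMap-inverse : ∀ {f g} → (∀ i → f (g i) ≡ i) → ∀ x → liftMap f (liftMap g x) ≡ x
  liftMap-inverse {f} {g} f∘g x with vertex x
  ... | at-w = refl
  ... | at-u i s =
    trans (cong (liftMap f) (liftMap-u′ g i s)) (trans (liftMap-u′ f (g i) s) (cong (λ k → u′ k s) (f∘g i)))

  lift : Permutation′ n → Permutation′ N
  lift σ = permutation (liftMap (σ ⟨$⟩ʳ_)) (liftMap (σ ⟨$⟩ˡ_))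
                       (liftMap-inverse (λ _ → inverseʳ σ)) (liftMap-inverse (λ _ → inverseˡ σ))

  lift-u′ : ∀ σ i s → lift σ ⟨$⟩ʳ u′ i s ≡ u′ (σ ⟨$⟩ʳ i) s
  lift-u′ σ = liftMap-u′ (σ ⟨$⟩ʳ_)

  lift-isAutomorphism : ∀ {σ} → IsAutomorphism G σ → IsAutomorphism H (lift σ)
  lift-isAutomorphism {σ} aut x y with vertex x | vertex y
  ... | at-w | at-w = refl
  ... | at-w | at-u j r = trans (cong (H w′) (lift-u′ σ j r)) (trans (H-w′u′ _ r) (sym (H-w′u′ j r)))
  ... | at-u i s | at-w = trans (cong (λ a → H a w′) (lift-u′ σ i s)) (trans (H-u′w′ _ s) (sym (H-u′w′ i s)))
  ... | at-u i s | at-u j r = begin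
    H (lift σ ⟨$⟩ʳ u′ i s) (lift σ ⟨$⟩ʳ u′ j r)                ≡⟨ cong₂ H (lift-u′ σ i s) (lift-u′ σ j r) ⟩
    H (u′ (σ ⟨$⟩ʳ i) s) (u′ (σ ⟨$⟩ʳ j) r)                     ≡⟨ H-u′u′ _ s _ r ⟩
    G (σ ⟨$⟩ʳ i) (σ ⟨$⟩ʳ j) ∧ levelLink (toℕ s) (toℕ r)        ≡⟨ cong (_∧ _) (aut i j) ⟩
    G i j ∧ levelLink (toℕ s) (toℕ r)                          ≡⟨ H-u′u′ i s j r ⟨
    H (u′ i s) (u′ j r)                                        ∎
    where open ≡-Reasoning

  restrict : (ψ : Permutation′ N) (s : Fin (suc t)) →
    (∀ i → ∃ λ j → ψ ⟨$⟩ʳ u′ i s ≡ u′ j s) → (∀ i → ∃ λ j → ψ ⟨$⟩ˡ u′ i s ≡ u′ j s) → Permutation′ n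
  restrict ψ s to from = permutation (proj₁ ∘ to) (proj₁ ∘ from) to∘from from∘to
    where
    to∘from : ∀ i → proj₁ (to (proj₁ (from i))) ≡ i
    to∘from i = proj₁ (u′-injective (begin
      u′ (proj₁ (to (proj₁ (from i)))) s  ≡⟨ proj₂ (to (proj₁ (from i))) ⟨
      ψ ⟨$⟩ʳ u′ (proj₁ (from i)) s        ≡⟨ cong (ψ ⟨$⟩ʳ_) (proj₂ (from i)) ⟨
      ψ ⟨$⟩ʳ (ψ ⟨$⟩ˡ u′ i s)              ≡⟨ inverseʳ ψ ⟩
      u′ i s                              ∎))
      where open ≡-Reasoning
    from∘to : ∀ i → proj₁ (from (proj₁ (to i))) ≡ i
    from∘to i = proj₁ (u′-injective (begin
      u′ (proj₁ (from (proj₁ (to i)))) s  ≡⟨ proj₂ (from (proj₁ (to i))) ⟨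
      ψ ⟨$⟩ˡ u′ (proj₁ (to i)) s          ≡⟨ cong (ψ ⟨$⟩ˡ_) (proj₂ (to i)) ⟨
      ψ ⟨$⟩ˡ (ψ ⟨$⟩ʳ u′ i s)              ≡⟨ inverseˡ ψ ⟩
      u′ i s                              ∎))
      where open ≡-Reasoning

  slice : Subset N → Fin (suc t) → Subset n
  slice S s = tabulate (λ i → lookup S (u′ i s))

  ∈-slice⁺ : ∀ {S i s} → u′ i s ∈ S → i ∈ slice S s
  ∈-slice⁺ {S} {i} {s} u∈S = lookup⇒[]= i _ (trans (lookup∘tabulate _ i) ([]=⇒lookup u∈S))

  ∈-slice⁻ : ∀ {S i s} → i ∈ slice S s → u′ i s ∈ S
  ∈-slice⁻ {S} {i} {s} i∈ = lookup⇒[]= (u′ i s) S (trans (sym (lookup∘tabulate _ i)) ([]=⇒lookup i∈))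

  ∣slice∣≡∑ : ∀ S s → ∣ slice S s ∣ ≡ ∑[ i < n ] iverson (lookup S (u′ i s))
  ∣slice∣≡∑ S s = trans (∣p∣≡∑ (slice S s)) (sum-cong-≗ (cong iverson ∘ lookup∘tabulate (λ i → lookup S (u′ i s))))

  ∣S∣≡∑∣slice∣ : ∀ S → ∣ S ∣ ≡ iverson (lookup S w′) + ∑[ s < suc t ] ∣ slice S s ∣
  ∣S∣≡∑∣slice∣ S = trans (∣p∣≡∑ S) (cong (iverson (lookup S w′) +_) (begin
    ∑[ p < n * suc t ] iverson (lookup S (suc p))           ≡⟨ ∑-combine n (suc t) _ ⟩
    ∑[ i < n ] ∑[ s < suc t ] iverson (lookup S (u′ i s))   ≡⟨ ∑-comm (λ i s → iverson (lookup S (u′ i s))) ⟩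
    ∑[ s < suc t ] ∑[ i < n ] iverson (lookup S (u′ i s))   ≡⟨ sum-cong-≗ (∣slice∣≡∑ S) ⟨
    ∑[ s < suc t ] ∣ slice S s ∣                            ∎))
    where open ≡-Reasoning

  restrict₀-isAutomorphism : ∀ ψ → IsAutomorphism H ψ → ∀ to from → IsAutomorphism G (restrict ψ zero to from)
  restrict₀-isAutomorphism ψ aut to from i j = begin
    G (proj₁ (to i)) (proj₁ (to j))                  ≡⟨ H-u′₀u′₀ _ _ ⟨
    H (u′ (proj₁ (to i)) zero) (u′ (proj₁ (to j)) zero)  ≡⟨ cong₂ H (proj₂ (to i)) (proj₂ (to j)) ⟨
    H (ψ ⟨$⟩ʳ u′ i zero) (ψ ⟨$⟩ʳ u′ j zero)          ≡⟨ aut _ _ ⟩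
    H (u′ i zero) (u′ j zero)                        ≡⟨ H-u′₀u′₀ i j ⟩
    G i j                                            ∎
    where open ≡-Reasoning

  twins-above-fixed-level : ∀ ψ → IsAutomorphism H ψ → ∀ k →
    (∀ z → ψ ⟨$⟩ʳ u′ z (inject₁ k) ≡ u′ z (inject₁ k)) →
    ∀ {i j} → ψ ⟨$⟩ʳ u′ i (suc k) ≡ u′ j (suc k) → Twins G j i
  twins-above-fixed-level ψ aut k fixed {i} {j} ψi≡j z = begin
    G j z                                                  ≡⟨ H-u′-prev j k z ⟨
    H (u′ j (suc k)) (u′ z (inject₁ k))                    ≡⟨ cong₂ H ψi≡j (fixed z) ⟨
    H (ψ ⟨$⟩ʳ u′ i (suc k)) (ψ ⟨$⟩ʳ u′ z (inject₁ k))      ≡⟨ aut _ _ ⟩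
    H (u′ i (suc k)) (u′ z (inject₁ k))                    ≡⟨ H-u′-prev i k z ⟩
    G i z                                                  ∎
    where open ≡-Reasoning

-- The upper bound

innerLevel : ∀ {t} → Fin t → Bool
innerLevel {t} k = does (suc (toℕ k) <? t)

∑-innerLevel : ∀ t → ∑[ k < t ] iverson (innerLevel k) ≡ t ∸ 1
∑-innerLevel zero = refl
∑-innerLevel (suc t) = begin
  ∑[ k < suc t ] iverson (innerLevel k)
    ≡⟨ sum-init-last (λ k → iverson (innerLevel {suc t} k)) ⟩
  ∑[ k < t ] iverson (innerLevel (inject₁ k)) + iverson (innerLevel (fromℕ t))
    ≡⟨ cong₂ _+_ (sum-cong-≗ inner) last ⟩
  ∑[ k < t ] 1 + 0    ≡⟨ +-identityʳ _ ⟩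
  ∑[ k < t ] 1        ≡⟨ ∑-const t 1 ⟩
  t * 1               ≡⟨ *-identityʳ t ⟩
  t                   ∎
  where
  open ≡-Reasoning
  inner : ∀ k → iverson (innerLevel (inject₁ k)) ≡ 1
  inner k = cong iverson (dec-true (_ <? _) (s≤s (subst (_< t) (sym (Fin.toℕ-inject₁ k)) (Fin.toℕ<n k))))
  last : iverson (innerLevel (fromℕ t)) ≡ 0
  last = cong iverson (dec-false (_ <? _) (λ lt → 1+n≰n (subst (_< suc t) (cong suc (Fin.toℕ-fromℕ t)) lt)))

module UpperBound {n : ℕ} (G : Adj n) (G-sym : ∀ i j → G i j ≡ G j i) (t : ℕ)
  {D T : Subset n} (D-determining : IsDetermining G D) (T-cover : IsTwinCover G T)
  {i₀ : Fin n} (i₀-isolated : Isolated G i₀) (i₀∉T : i₀ ∉ T)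
  {a b : Fin n} (a≢b : a ≢ b) where

  open Mycielskian G G-sym t
  open GraphProperties

  levelSet : Fin (suc t) → Subset n
  levelSet zero = D
  levelSet (suc k) = if innerLevel k then T ∪ ⁅ i₀ ⁆ else T

  member : Fin N → Bool
  member zero = false
  member (suc p) = let (i , s) = remQuot {n} (suc t) p in lookup (levelSet s) i

  S : Subset N
  S = tabulate member

  slice-S : ∀ s → slice S s ≡ levelSet s
  slice-S s = trans (tabulate-cong member-u′) (tabulate∘lookup (levelSet s))
    where
    member-u′ : ∀ i → lookup S (u′ i s) ≡ lookup (levelSet s) i
    member-u′ i = trans (lookup∘tabulate member (u′ i s))
                        (cong (λ (i , s) → lookup (levelSet s) i) (Fin.remQuot-combine i s))

  u′∈S : ∀ {i s} → i ∈ levelSet s → u′ i s ∈ S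
  u′∈S {i} {s} i∈ = ∈-slice⁻ (subst (i ∈_) (sym (slice-S s)) i∈)

  T⊆levelSet : ∀ k {i} → i ∈ T → i ∈ levelSet (suc k)
  T⊆levelSet k i∈T with innerLevel k
  ... | true = p⊆p∪q ⁅ i₀ ⁆ i∈T
  ... | false = i∈T

  i₀∈levelSet : ∀ k → suc (toℕ k) < t → i₀ ∈ levelSet (suc k)
  i₀∈levelSet k k+1<t rewrite dec-true (suc (toℕ k) <? t) k+1<t = q⊆p∪q T ⁅ i₀ ⁆ (x∈⁅x⁆ i₀)

  ∣levelSet∣ : ∀ k → ∣ levelSet (suc k) ∣ ≡ ∣ T ∣ + iverson (innerLevel k)
  ∣levelSet∣ k with innerLevel k
  ... | true = trans (x∉p⇒∣p∪⁅x⁆∣≡1+∣p∣ i₀∉T) (+-comm 1 ∣ T ∣)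
  ... | false = sym (+-identityʳ ∣ T ∣)

  ∣S∣ : ∣ S ∣ ≡ t * ∣ T ∣ + ∣ D ∣ + (t ∸ 1)
  ∣S∣ = begin
    ∣ S ∣                                                   ≡⟨ ∣S∣≡∑∣slice∣ S ⟩
    ∑[ s < suc t ] ∣ slice S s ∣                            ≡⟨ sum-cong-≗ (cong ∣_∣ ∘ slice-S) ⟩
    ∣ D ∣ + ∑[ k < t ] ∣ levelSet (suc k) ∣                 ≡⟨ cong (∣ D ∣ +_) (sum-cong-≗ ∣levelSet∣) ⟩
    ∣ D ∣ + ∑[ k < t ] (∣ T ∣ + iverson (innerLevel k))
      ≡⟨ cong (∣ D ∣ +_) (∑-distrib-+ {t} (λ _ → ∣ T ∣) (λ k → iverson (innerLevel k))) ⟩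
    ∣ D ∣ + (∑[ k < t ] ∣ T ∣ + ∑[ k < t ] iverson (innerLevel k))
      ≡⟨ cong (∣ D ∣ +_) (cong₂ _+_ (∑-const t ∣ T ∣) (∑-innerLevel t)) ⟩
    ∣ D ∣ + (t * ∣ T ∣ + (t ∸ 1))                            ≡⟨ +-assoc ∣ D ∣ (t * ∣ T ∣) (t ∸ 1) ⟨
    ∣ D ∣ + t * ∣ T ∣ + (t ∸ 1)                             ≡⟨ cong (_+ (t ∸ 1)) (+-comm ∣ D ∣ (t * ∣ T ∣)) ⟩
    t * ∣ T ∣ + ∣ D ∣ + (t ∸ 1)                             ∎
    where open ≡-Reasoning

  isolated-copy-in-S : ∀ {i s} → Isolated G i → toℕ s < t → u′ i s ∈ S ⊎ (s ≡ zero × i ∉ D)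
  isolated-copy-in-S {i} {zero} _ _ with i ∈? D
  ... | yes i∈D = inj₁ (u′∈S i∈D)
  ... | no i∉D = inj₂ (refl , i∉D)
  isolated-copy-in-S {i} {suc k} iso k+1<t with i Fin.≟ i₀
  ... | yes refl = inj₁ (u′∈S (i₀∈levelSet k k+1<t))
  ... | no i≢i₀ with T-cover i i₀ i≢i₀ (isolated⇒twins G iso i₀-isolated)
  ...   | inj₁ i∈T = inj₁ (u′∈S (T⊆levelSet k i∈T))
  ...   | inj₂ i₀∈T = contradiction i₀∈T i₀∉T

  isolated-pairCover : PairCover (λ x y → Isolated H x × Isolated H y) S
  isolated-pairCover x y x≢y (x-iso , y-iso) with vertex x | vertex y
  ... | at-w | _ = contradiction x-iso (w′-not-isolated a)
  ... | at-u _ _ | at-w = contradiction y-iso (w′-not-isolated a)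
  ... | at-u i s | at-u j r with isolated-u′ x-iso | isolated-u′ y-iso
  ...   | i-iso , s<t | j-iso , r<t with isolated-copy-in-S i-iso s<t | isolated-copy-in-S j-iso r<t
  ...     | inj₁ x∈S | _ = inj₁ x∈S
  ...     | inj₂ _ | inj₁ y∈S = inj₂ y∈S
  ...     | inj₂ (refl , i∉D) | inj₂ (refl , j∉D) =
    contradiction (determining⇒twinCover G G-sym D-determining i j i≢j (isolated⇒twins G i-iso j-iso))
                  Sum.[ i∉D , j∉D ]
    where
    i≢j : i ≢ j
    i≢j i≡j = x≢y (cong (λ k → u′ k zero) i≡j)

  module Fixing (ψ : Permutation′ N) (aut : IsAutomorphism H ψ) (fixes : ∀ x → x ∈ S → ψ ⟨$⟩ʳ x ≡ x) where

    ψ-w′ : ψ ⟨$⟩ʳ w′ ≡ w′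
    ψ-w′ = pendant-neighbour≡w′ a≢b (ψ ⟨$⟩ʳ ℓ) (ψ ⟨$⟩ʳ w′) (trans (aut ℓ w′) ℓ-w′) sole
      where
      ℓ : Fin N
      ℓ = u′ i₀ top
      ℓ-w′ : H ℓ w′ ≡ true
      ℓ-w′ = trans (H-u′w′ i₀ top) (≡ᵇ-true (Fin.toℕ-fromℕ t))
      ℓ-sole : ∀ z → H ℓ z ≡ true → z ≡ w′
      ℓ-sole z adj with vertex z
      ... | at-w = refl
      ... | at-u j r =
        contradiction (trans (sym adj) (trans (H-u′u′ i₀ top j r) (cong (_∧ _) (i₀-isolated j)))) λ ()
      sole : ∀ z′ → H (ψ ⟨$⟩ʳ ℓ) z′ ≡ true → z′ ≡ ψ ⟨$⟩ʳ w′
      sole z′ adj = trans (sym (inverseʳ ψ))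
                          (cong (ψ ⟨$⟩ʳ_) (ℓ-sole _ (trans (sym (automorphism-adj H ψ aut ℓ z′)) adj)))

    level-map : ∀ s i → ∃ λ j → ψ ⟨$⟩ʳ u′ i s ≡ u′ j s
    level-map s i with isolated-or-nonIsolated G i | toℕ s ≟ t
    ... | inj₂ i-nonIso | _ = level-preserved ψ aut ψ-w′ (inj₁ i-nonIso)
    ... | inj₁ _ | yes s≡t = level-preserved ψ aut ψ-w′ (inj₂ s≡t)
    ... | inj₁ i-iso | no s≢t =
      i , fixed-by-pairCover (⟨$⟩ʳ-injective ψ) fixes isolated-pairCover {u′ i s}
                             (automorphism-isolated H ψ aut x-iso , x-iso)
      where
      x-iso : Isolated H (u′ i s)
      x-iso = u′-isolated s i-iso (below-top s s≢t)

    fixed-above : ∀ k → (∀ z → ψ ⟨$⟩ʳ u′ z (inject₁ k) ≡ u′ z (inject₁ k)) →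
                  ∀ i → ψ ⟨$⟩ʳ u′ i (suc k) ≡ u′ i (suc k)
    fixed-above k fixed-below i =
      trans (f-spec i) (cong (λ j → u′ j (suc k))
        (fixed-by-pairCover f-injective f-fixes-T T-cover (twins-above-fixed-level ψ aut k fixed-below (f-spec i))))
      where
      f : Fin n → Fin n
      f i = proj₁ (level-map (suc k) i)
      f-spec : ∀ i → ψ ⟨$⟩ʳ u′ i (suc k) ≡ u′ (f i) (suc k)
      f-spec i = proj₂ (level-map (suc k) i)
      f-injective : Injective _≡_ _≡_ f
      f-injective {x} {y} fx≡fy = proj₁ (u′-injective (⟨$⟩ʳ-injective ψ
        (trans (f-spec x) (trans (cong (λ j → u′ j (suc k)) fx≡fy) (sym (f-spec y))))))
      f-fixes-T : ∀ i → i ∈ T → f i ≡ i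
      f-fixes-T i i∈T = proj₁ (u′-injective (trans (sym (f-spec i)) (fixes _ (u′∈S (T⊆levelSet k i∈T)))))

  S-determining : IsDetermining H S
  S-determining ψ aut fixes x with vertex x
  ... | at-w = Fixing.ψ-w′ ψ aut fixes
  ... | at-u i s = fixed-level (toℕ s) s refl i
    where
    module ψ = Fixing ψ aut fixes
    module ψ⁻¹ = Fixing (flip ψ) (flip-isAutomorphism H ψ aut)
                        (λ x x∈S → trans (cong (ψ ⟨$⟩ˡ_) (sym (fixes x x∈S))) (inverseˡ ψ))
    σ : Permutation′ n
    σ = restrict ψ zero (ψ.level-map zero) (ψ⁻¹.level-map zero)
    σ-automorphism : IsAutomorphism G σ
    σ-automorphism = restrict₀-isAutomorphism ψ aut (ψ.level-map zero) (ψ⁻¹.level-map zero)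
    σ-fixes-D : ∀ i → i ∈ D → σ ⟨$⟩ʳ i ≡ i
    σ-fixes-D i i∈D = proj₁ (u′-injective (trans (sym (proj₂ (ψ.level-map zero i))) (fixes _ (u′∈S i∈D))))
    fixed-level : ∀ k s → toℕ s ≡ k → ∀ i → ψ ⟨$⟩ʳ u′ i s ≡ u′ i s
    fixed-level zero zero _ i =
      trans (proj₂ (ψ.level-map zero i)) (cong (λ j → u′ j zero) (D-determining σ σ-automorphism σ-fixes-D i))
    fixed-level zero (suc s) ()
    fixed-level (suc k) zero ()
    fixed-level (suc k) (suc s) 1+s≡1+k =
      ψ.fixed-above s (fixed-level k (inject₁ s) (trans (Fin.toℕ-inject₁ s) (suc-injective 1+s≡1+k)))

-- The lower bound

module LowerBound {n : ℕ} (G : Adj n) (G-sym : ∀ i j → G i j ≡ G j i) (t : ℕ)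
  {T : Subset n} (T-min : IsMinTwinCover G T) {v : Fin n} (v-isolated : Isolated G v)
  {S′ : Subset (suc (n * suc t))} (S′-determining : IsDetermining (μ t G) S′) where

  open Mycielskian G G-sym t
  open GraphProperties

  S′-cover : IsTwinCover H S′
  S′-cover = determining⇒twinCover H H-sym S′-determining

  slice-cover : ∀ s → IsTwinCover G (slice S′ s)
  slice-cover s x y x≢y tw =
    Sum.map ∈-slice⁺ ∈-slice⁺ (S′-cover (u′ x s) (u′ y s) (x≢y ∘ proj₁ ∘ u′-injective) (u′-twins s tw))

  hasTwin? : Decidable (HasTwin G)
  hasTwin? i = any? (λ j → ¬? (j Fin.≟ i) ×-dec all? (λ z → G i z Bool.≟ G j z))

  Occupied : Fin n → Set
  Occupied i = ∃ λ s → i ∈ slice S′ s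

  occupied? : Decidable Occupied
  occupied? i = any? (λ s → i ∈? slice S′ s)

  Lonely : Fin n → Set
  Lonely i = Occupied i × ¬ Isolated G i × ¬ HasTwin G i

  lonely? : Decidable Lonely
  lonely? i = occupied? i ×-dec (¬? (isolated? G i) ×-dec ¬? (hasTwin? i))

  Q : Subset n
  Q = subsetOf lonely?

  Q-twinless : ∀ i → i ∈ Q → ¬ HasTwin G i
  Q-twinless i i∈Q = proj₂ (proj₂ (∈-subsetOf⁻ lonely? i∈Q))

  isolated∉Q : ∀ {i} → Isolated G i → i ∉ Q
  isolated∉Q iso i∈Q = proj₁ (proj₂ (∈-subsetOf⁻ lonely? i∈Q)) iso

  T∪Q-determining : IsDetermining G (T ∪ Q)
  T∪Q-determining σ aut fixes i = proj₁ (u′-injective (trans (sym (lift-u′ σ i zero)) (lift-identity (u′ i zero))))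
    where
    fixes-T : ∀ i → i ∈ T → σ ⟨$⟩ʳ i ≡ i
    fixes-T i i∈T = fixes i (p⊆p∪q Q i∈T)
    fixed-if-twin : ∀ {i} → Twins G (σ ⟨$⟩ʳ i) i → σ ⟨$⟩ʳ i ≡ i
    fixed-if-twin = fixed-by-pairCover (⟨$⟩ʳ-injective σ) fixes-T (proj₁ T-min)
    fixes-occupied : ∀ i → Occupied i → σ ⟨$⟩ʳ i ≡ i
    fixes-occupied i occ with i ∈? T | isolated? G i | hasTwin? i
    ... | yes i∈T | _ | _ = fixes-T i i∈T
    ... | no _ | yes iso | _ = fixed-if-twin (isolated⇒twins G (automorphism-isolated G σ aut iso) iso)
    ... | no i∉T | no ¬iso | yes (j , j≢i , tw) with proj₁ T-min i j (j≢i ∘ sym) tw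
    ...   | inj₁ i∈T = contradiction i∈T i∉T
    ...   | inj₂ j∈T = fixed-if-twin λ z →
            trans (automorphism-twins G σ aut tw z) (trans (cong (λ k → G k z) (fixes-T j j∈T)) (sym (tw z)))
    fixes-occupied i occ | no _ | no ¬iso | no ¬twin =
      fixes i (q⊆p∪q T Q (∈-subsetOf⁺ lonely? (occ , ¬iso , ¬twin)))
    lift-fixes : ∀ x → x ∈ S′ → lift σ ⟨$⟩ʳ x ≡ x
    lift-fixes x x∈S′ with vertex x
    ... | at-w = refl
    ... | at-u i s = trans (lift-u′ σ i s) (cong (λ k → u′ k s) (fixes-occupied i (s , ∈-slice⁺ x∈S′)))
    lift-identity : ∀ x → lift σ ⟨$⟩ʳ x ≡ x
    lift-identity = S′-determining (lift σ) (lift-isAutomorphism {σ} aut) lift-fixes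

  T≤∣slice─Q∣ : ∀ s → ∣ T ∣ ≤ ∣ slice S′ s ─ Q ∣
  T≤∣slice─Q∣ s = proj₂ T-min _ (twinCover-─ G (slice-cover s) Q-twinless)

  Missing : Fin t → Set
  Missing k = ∃ λ i → Isolated G i × i ∉ slice S′ (inject₁ k)

  missing? : Decidable Missing
  missing? k = any? (λ i → isolated? G i ×-dec ¬? (i ∈? slice S′ (inject₁ k)))

  complete : Subset t
  complete = subsetOf (¬? ∘ missing?)

  1+T≤∣slice─Q∣ : ∀ k → k ∈ complete → suc ∣ T ∣ ≤ ∣ slice S′ (inject₁ k) ─ Q ∣
  1+T≤∣slice─Q∣ k k-complete = ≤-trans (s≤s (proj₂ T-min _ cover)) (x∈p⇒∣p-x∣<∣p∣ (v∈C v-isolated))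
    where
    C : Subset n
    C = slice S′ (inject₁ k) ─ Q
    v∈C : ∀ {i} → Isolated G i → i ∈ C
    v∈C {i} iso with i ∈? slice S′ (inject₁ k)
    ... | yes i∈ = x∈p∧x∉q⇒x∈p─q i∈ (isolated∉Q iso)
    ... | no i∉ = contradiction (i , iso , i∉) (∈-subsetOf⁻ (¬? ∘ missing?) k-complete)
    cover : IsTwinCover G (C - v)
    cover = twinCover-remove G (twinCover-─ G (slice-cover _) Q-twinless)
                             (λ y _ tw → v∈C (twins-isolated G tw v-isolated))

  complete-pairCover : ∀ k₁ k₂ → k₁ ≢ k₂ → k₁ ∈ complete ⊎ k₂ ∈ complete
  complete-pairCover k₁ k₂ k₁≢k₂ with missing? k₁ | missing? k₂
  ... | no ¬m₁ | _ = inj₁ (∈-subsetOf⁺ (¬? ∘ missing?) ¬m₁)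
  ... | yes _ | no ¬m₂ = inj₂ (∈-subsetOf⁺ (¬? ∘ missing?) ¬m₂)
  ... | yes (i₁ , iso₁ , i₁∉) | yes (i₂ , iso₂ , i₂∉) =
    contradiction (S′-cover x₁ x₂ x₁≢x₂ (isolated⇒twins H {x₁} {x₂} (x-isolated iso₁) (x-isolated iso₂)))
                  Sum.[ i₁∉ ∘ ∈-slice⁺ , i₂∉ ∘ ∈-slice⁺ ]
    where
    x₁ x₂ : Fin N
    x₁ = u′ i₁ (inject₁ k₁)
    x₂ = u′ i₂ (inject₁ k₂)
    x-isolated : ∀ {i k} → Isolated G i → Isolated H (u′ i (inject₁ k))
    x-isolated {k = k} iso = u′-isolated (inject₁ k) iso (subst (_< t) (sym (Fin.toℕ-inject₁ k)) (Fin.toℕ<n k))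
    x₁≢x₂ : x₁ ≢ x₂
    x₁≢x₂ eq = k₁≢k₂ (Fin.inject₁-injective (proj₂ (u′-injective eq)))

  levels-bound : t * ∣ T ∣ + (t ∸ 1) + ∣ T ∣ ≤ ∑[ s < suc t ] ∣ slice S′ s ─ Q ∣
  levels-bound = begin
    t * ∣ T ∣ + (t ∸ 1) + ∣ T ∣
      ≤⟨ +-monoˡ-≤ ∣ T ∣ (+-monoʳ-≤ (t * ∣ T ∣) t-1≤∣complete∣) ⟩
    t * ∣ T ∣ + ∣ complete ∣ + ∣ T ∣
      ≡⟨ cong (_+ ∣ T ∣) (cong₂ _+_ (∑-const t ∣ T ∣) (sym (∣p∣≡∑ complete))) ⟨
    ∑[ k < t ] ∣ T ∣ + ∑[ k < t ] iverson (lookup complete k) + ∣ T ∣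
      ≡⟨ cong (_+ ∣ T ∣) (∑-distrib-+ {t} (λ _ → ∣ T ∣) (iverson ∘ lookup complete)) ⟨
    ∑[ k < t ] (∣ T ∣ + iverson (lookup complete k)) + ∣ T ∣
      ≤⟨ +-mono-≤ (∑-mono-≤ {t} middle) (T≤∣slice─Q∣ top) ⟩
    ∑[ k < t ] ∣ slice S′ (inject₁ k) ─ Q ∣ + ∣ slice S′ top ─ Q ∣
      ≡⟨ sum-init-last (λ s → ∣ slice S′ s ─ Q ∣) ⟨
    ∑[ s < suc t ] ∣ slice S′ s ─ Q ∣
      ∎
    where
    open ≤-Reasoning
    t-1≤∣complete∣ : t ∸ 1 ≤ ∣ complete ∣
    t-1≤∣complete∣ = ∸-monoˡ-≤ 1 (meetsAllPairs⇒n≤1+∣p∣ complete complete-pairCover)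
    middle : ∀ k → ∣ T ∣ + iverson (lookup complete k) ≤ ∣ slice S′ (inject₁ k) ─ Q ∣
    middle k with lookup complete k in eq
    ... | true = subst (_≤ ∣ slice S′ (inject₁ k) ─ Q ∣) (+-comm 1 ∣ T ∣)
                       (1+T≤∣slice─Q∣ k (lookup⇒[]= k complete eq))
    ... | false = subst (_≤ ∣ slice S′ (inject₁ k) ─ Q ∣) (sym (+-identityʳ ∣ T ∣)) (T≤∣slice─Q∣ (inject₁ k))

  Q≤∑∣slice∩Q∣ : ∣ Q ∣ ≤ ∑[ s < suc t ] ∣ slice S′ s ∩ Q ∣
  Q≤∑∣slice∩Q∣ = ∣p∣≤∑∣qₛ∣ Q (λ s → slice S′ s ∩ Q) λ {i} i∈Q →
    let (s , i∈slice) = proj₁ (∈-subsetOf⁻ lonely? i∈Q) in s , x∈p∩q⁺ (i∈slice , i∈Q)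

  lower-bound : ∀ {d} → (∀ S → IsDetermining G S → d ≤ ∣ S ∣) → t * ∣ T ∣ + d + (t ∸ 1) ≤ ∣ S′ ∣
  lower-bound {d} d-min = begin
    t * ∣ T ∣ + d + (t ∸ 1)                      ≤⟨ +-monoˡ-≤ (t ∸ 1) (+-monoʳ-≤ (t * ∣ T ∣) d≤T+Q) ⟩
    t * ∣ T ∣ + (∣ T ∣ + ∣ Q ∣) + (t ∸ 1)        ≡⟨ rearrange (t * ∣ T ∣) ∣ T ∣ ∣ Q ∣ (t ∸ 1) ⟩
    t * ∣ T ∣ + (t ∸ 1) + ∣ T ∣ + ∣ Q ∣          ≤⟨ +-mono-≤ levels-bound Q≤∑∣slice∩Q∣ ⟩
    ∑[ s < suc t ] ∣ slice S′ s ─ Q ∣ + ∑[ s < suc t ] ∣ slice S′ s ∩ Q ∣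
      ≡⟨ ∑-distrib-+ {suc t} (λ s → ∣ slice S′ s ─ Q ∣) (λ s → ∣ slice S′ s ∩ Q ∣) ⟨
    ∑[ s < suc t ] (∣ slice S′ s ─ Q ∣ + ∣ slice S′ s ∩ Q ∣)
      ≡⟨ sum-cong-≗ (λ s → ∣p∣≡∣p─q∣+∣p∩q∣ (slice S′ s) Q) ⟨
    ∑[ s < suc t ] ∣ slice S′ s ∣                ≤⟨ m≤n+m _ (iverson (lookup S′ w′)) ⟩
    iverson (lookup S′ w′) + ∑[ s < suc t ] ∣ slice S′ s ∣
      ≡⟨ ∣S∣≡∑∣slice∣ S′ ⟨
    ∣ S′ ∣                                        ∎
    where
    open ≤-Reasoning
    d≤T+Q : d ≤ ∣ T ∣ + ∣ Q ∣
    d≤T+Q = ≤-trans (d-min _ T∪Q-determining) (∣p∪q∣≤∣p∣+∣q∣ T Q)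
    rearrange : ∀ a b c e → a + (b + c) + e ≡ a + e + b + c
    rearrange = solve-∀

theorem3p17 : ∀ {n : ℕ} (G : Adj n) → IsSimple G → HasDistinctTwins G → HasIsolatedVertex G →
    ∀ (T : Subset n) → IsMinTwinCover G T →
    ∀ (t : ℕ) → 1 ≤ t →
    ∀ (d : ℕ) → Det G d → Det (μ t G) (t * ∣ T ∣ + d + (t ∸ 1))
theorem3p17 G (G-sym , _) (a , b , a≢b , _) (v , v-isolated) T T-min t _ d ((D , D-determining , ∣D∣≡d) , d-min)
  with minTwinCover-avoids-isolated T-min v-isolated
... | i₀ , i₀-isolated , i₀∉T =
  (S , S-determining , trans ∣S∣ (cong (λ k → t * ∣ T ∣ + k + (t ∸ 1)) ∣D∣≡d)) ,
  λ S′ S′-determining → LowerBound.lower-bound G G-sym t T-min v-isolated S′-determining d-min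
  where open UpperBound G G-sym t D-determining (proj₁ T-min) i₀-isolated i₀∉T a≢b
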